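{- Let $q$ be a prime power and $r$ a positive rational number such that $q^r$ is an integer greater than $1$. Let $\mathcal{C}\ne\emptyset$ be a $q^r$-divisible set of points in $\mathrm{PG}(v-1,\mathbb{F}_q)$ with $|\mathcal{C}|=aq^{r+1}+b$ for some integers $a,b$, and let $y$ be a nonnegative integer with $y\equiv(q-1)b\pmod{q^{r+1}}$. Then $(b+y)/q$ is an integer and there exists a hyperplane $H$ such that $|\mathcal{C}\cap H|\le(a-1)q^r+\frac{b+y}{q}$ and $|\mathcal{C}\cap H|\equiv b\pmod{q^r}$.
   Context: Points are $1$-dimensional subspaces of $\mathbb{F}_q^v$, hyperplanes $(v-1)$-dimensional subspaces. For an integer $\Delta>1$, a point set $\mathcal{C}$ is $\Delta$-divisible if $|\mathcal{C}\cap H|\equiv|\mathcal{C}|\pmod\Delta$ for every hyperplane $H$, where $\mathcal{C}\cap H$ is the set of points of $\mathcal{C}$ contained in $H$. -}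

module Defs where

open import Level using (0ℓ)
open import Data.Nat as ℕ using (ℕ; _^_)
open import Data.Nat.Primality using (Prime)
open import Data.Integer as ℤ using (ℤ; +_)
open import Data.Integer.Divisibility using (_∣_)
open import Data.Fin using (Fin)
open import Data.Vec using (Vec; []; _∷_; replicate; map; zipWith; foldr)
open import Data.List as List using (List; length; filter)
open import Data.List.Relation.Unary.AllPairs using (AllPairs)
open import Data.List.Relation.Unary.All using (All)
open import Data.Product using (Σ; ∃; _×_; _,_)
open import Relation.Nullary using (¬_)
open import Relation.Binary.PropositionalEquality using (_≡_; _≢_)
open import Relation.Binary.Definitions using (DecidableEquality)
open import Algebra.Structures using (IsCommutativeRing)
open import Function.Bundles using (_↔_)

IsPrimePower : ℕ → Set
IsPrimePower q = Σ ℕ λ p → Σ ℕ λ k → Prime p × (1 ℕ.≤ k) × (q ≡ p ^ k)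

record FiniteField (q : ℕ) : Set₁ where
  infixl 6 _+_
  infixl 7 _*_
  field
    Carrier : Set
    _+_ _*_ : Carrier → Carrier → Carrier
    -_      : Carrier → Carrier
    0# 1#   : Carrier
    isCommutativeRing : IsCommutativeRing _≡_ _+_ _*_ -_ 0# 1#
    0≢1     : 0# ≢ 1#
    inverse : ∀ x → x ≢ 0# → ∃ λ y → x * y ≡ 1#
    _≟_     : DecidableEquality Carrier
    enum    : Fin q ↔ Carrier

infix 4 _≋_[mod_]
_≋_[mod_] : ℤ → ℤ → ℤ → Set
x ≋ y [mod m ] = m ∣ (x ℤ.- y)

module Geometry {q : ℕ} (𝔽 : FiniteField q) (v : ℕ) where
  open FiniteField 𝔽

  V : Set
  V = Vec Carrier v

  zeroV : V
  zeroV = replicate v 0#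

  NonZero : V → Set
  NonZero x = x ≢ zeroV

  _·_ : V → V → Carrier
  x · y = foldr _ _+_ 0# (zipWith _*_ x y)

  scale : Carrier → V → V
  scale c x = map (c *_) x

  SamePoint : V → V → Set
  SamePoint x y = ∃ λ c → y ≡ scale c x

  -- A point set of PG(v-1,F_q): a list of nonzero representative vectors,
  -- one for each point, no two representing the same point.
  record PointSet : Set where
    field
      reps     : List V
      nonzero  : All NonZero reps
      distinct : AllPairs (λ x y → ¬ SamePoint x y) reps

  open PointSet public

  size : PointSet → ℕ
  size C = length (reps C)

  -- A hyperplane is given by a nonzero linear functional h (its kernel);
  -- a point ⟨x⟩ lies in the hyperplane iff h · x = 0.
  Hyperplane : Set
  Hyperplane = Σ V NonZero

  _∈H_ : V → Hyperplane → Set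
  x ∈H (h , _) = h · x ≡ 0#

  meet : PointSet → Hyperplane → ℕ
  meet C (h , _) = length (filter (λ x → (h · x) ≟ 0#) (reps C))

  Divisible : ℕ → PointSet → Set
  Divisible Δ C = ∀ (H : Hyperplane) → (+ meet C H) ≋ (+ size C) [mod (+ Δ) ]

-- Count the pairs (h, x) of a linear functional h on F_q^v and a point x of C with h · x = 0:
-- every point is annihilated by exactly q^(v-1) functionals, so on average ker h contains |C|/q
-- points of C.  The zero functional, containing all |C| of them, lies strictly above average, so
-- some nonzero h, i.e. some hyperplane H, has q |C ∩ H| < |C|.  Writing y = kΔq + (q-1)b,
-- m = b + kΔ and B = (a-1)Δ + m, one has b + y = mq and q (B + Δ) = |C| + y ≥ |C| > q |C ∩ H|,
-- so |C ∩ H| < B + Δ; since |C ∩ H| ≡ |C| ≡ b ≡ B (mod Δ), this forces |C ∩ H| ≤ B.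
module Submission where

open import Defs
open import Data.Nat as ℕ using (ℕ; _^_; _∸_)
open import Data.Integer as ℤ using (ℤ; +_; ∣_∣)
open import Data.Rational using (ℚ; 0ℚ; ↥_; ↧ₙ_)
open import Data.Rational as ℚ using ()
open import Data.List using ([])
open import Data.Product using (Σ; _×_)
open import Relation.Binary.PropositionalEquality using (_≡_; _≢_)

open import Data.Nat using (zero; suc)
open import Algebra.Bundles using (Group)
open import Algebra.Structures using (IsCommutativeRing)
import Data.Nat.Properties as ℕP
open import Data.Nat.ListAction using (sum)
open import Data.Integer.Divisibility.Signed using (divides; ∣ᵤ⇒∣; ∣⇒∣ᵤ; ∣m∣n⇒∣m+n)
import Data.Integer.Properties as ℤP
open import Data.Integer.Tactic.RingSolver using (solve-∀)
open import Data.Fin using (Fin; zero)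
open import Data.List using (List; _∷_; [_]; _++_; map; length; filter; allFin; cartesianProductWith)
open import Data.List.Properties
  using (length-++; length-map; length-tabulate; map-cong; map-cong-local;
         filter-++; filter-all; filter-none; filter-≐)
open import Data.List.Membership.Propositional using (_∈_; lose)
open import Data.List.Membership.Propositional.Properties
  using (∈-map⁺; ∈-allFin; ∈-cartesianProductWith⁺)
open import Data.List.Relation.Unary.All as All using (All; []; _∷_)
open import Data.List.Relation.Unary.All.Properties using (¬Any⇒All¬)
open import Data.List.Relation.Unary.AllPairs using (_∷_)
open import Data.List.Relation.Unary.Any as Any using (Any; here; there; any?)
open import Data.List.Relation.Unary.Unique.Propositional using (Unique)
import Data.List.Relation.Unary.Unique.Propositional.Properties as Unique
open import Data.Product using (∃; _,_)
open import Data.Vec using (Vec; []; _∷_; replicate)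
open import Function using (_∘_; flip; id)
open import Function.Bundles using (Inverse; _↔_)
open import Relation.Binary.Definitions using (DecidableEquality)
open import Relation.Binary.PropositionalEquality
  using (refl; sym; trans; cong; cong₂; subst; subst₂; module ≡-Reasoning)
open import Relation.Nullary using (Dec; yes; no; contradiction)
open import Relation.Unary using (Pred; Decidable; _≐_)

count : ∀ {A : Set} {ℓ} {P : Pred A ℓ} → Decidable P → List A → ℕ
count P? xs = length (filter P? xs)

module _ {A : Set} where
  open import Data.Nat using (_+_; _*_; _≤_; _<_)
  open import Algebra.Properties.CommutativeSemigroup ℕP.+-commutativeSemigroup using (interchange)

  length-nonZero : {xs : List A} → xs ≢ [] → ℕ.NonZero (length xs)
  length-nonZero {[]}    []≢[] = contradiction refl []≢[]
  length-nonZero {_ ∷ _} _     = _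

  count-++ : ∀ {ℓ} {P : Pred A ℓ} (P? : Decidable P) (xs ys : List A) →
             count P? (xs ++ ys) ≡ count P? xs + count P? ys
  count-++ P? xs ys = trans (cong length (filter-++ P? xs ys)) (length-++ (filter P? xs))

  count-map : ∀ {ℓ} {P : Pred A ℓ} {B : Set} (P? : Decidable P) (f : B → A) xs →
              count P? (map f xs) ≡ count (P? ∘ f) xs
  count-map P? f []       = refl
  count-map P? f (x ∷ xs) with P? (f x)
  ... | yes _ = cong suc (count-map P? f xs)
  ... | no _  = count-map P? f xs

  count-≟-unique : (_≟_ : DecidableEquality A) {x : A} {xs : List A} →
                   Unique xs → x ∈ xs → count (_≟ x) xs ≡ 1
  count-≟-unique _≟_ {x} {y ∷ ys} (y∉ys ∷ ys-unique) x∈y∷ys with y ≟ x | x∈y∷ys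
  ... | yes refl | _          = cong suc (cong length (filter-none (_≟ y) (All.map (_∘ sym) y∉ys)))
  ... | no y≢x   | here x≡y   = contradiction (sym x≡y) y≢x
  ... | no _     | there x∈ys = count-≟-unique _≟_ ys-unique x∈ys

  sum-map-const : ∀ k (xs : List A) → sum (map (λ _ → k) xs) ≡ length xs * k
  sum-map-const k []       = refl
  sum-map-const k (x ∷ xs) = cong (_+_ k) (sum-map-const k xs)

  sum-map-*ˡ : ∀ k (f : A → ℕ) xs → sum (map (λ x → k * f x) xs) ≡ k * sum (map f xs)
  sum-map-*ˡ k f []       = sym (ℕP.*-zeroʳ k)
  sum-map-*ˡ k f (x ∷ xs) = trans (cong (_+_ (k * f x)) (sum-map-*ˡ k f xs))
                                  (sym (ℕP.*-distribˡ-+ k (f x) (sum (map f xs))))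

  sum-map-+ : ∀ (f g : A → ℕ) xs →
              sum (map (λ x → f x + g x) xs) ≡ sum (map f xs) + sum (map g xs)
  sum-map-+ f g []       = refl
  sum-map-+ f g (x ∷ xs) = trans (cong (_+_ (f x + g x)) (sum-map-+ f g xs))
                                 (interchange (f x) (g x) (sum (map f xs)) (sum (map g xs)))

  module _ (f : A → ℕ) (n : ℕ) where

    length*≤sum : {xs : List A} → All (λ x → n ≤ f x) xs → length xs * n ≤ sum (map f xs)
    length*≤sum []             = ℕ.z≤n
    length*≤sum (n≤fx ∷ n≤fxs) = ℕP.+-mono-≤ n≤fx (length*≤sum n≤fxs)

    length*<sum : {xs : List A} → All (λ x → n ≤ f x) xs → Any (λ x → n < f x) xs →
                  length xs * n < sum (map f xs)
    length*<sum (_ ∷ n≤fxs)    (here n<fx)   = ℕP.+-mono-<-≤ n<fx (length*≤sum n≤fxs)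
    length*<sum (n≤fx ∷ n≤fxs) (there above) = ℕP.+-mono-≤-< n≤fx (length*<sum n≤fxs above)

    below-average : {xs : List A} → sum (map f xs) ≤ length xs * n →
                    Any (λ x → n < f x) xs → Any (λ x → f x < n) xs
    below-average {xs} sum≤ above with any? (λ x → f x ℕ.<? n) xs
    ... | yes below = below
    ... | no ¬below = contradiction sum≤
                        (ℕP.<⇒≱ (length*<sum (All.map ℕP.≮⇒≥ (¬Any⇒All¬ xs ¬below)) above))

module _ {A B : Set} {ℓ} {R : A → B → Set ℓ} (R? : ∀ x y → Dec (R x y)) where
  open import Data.Nat using (_+_)

  sum-count-singleton : ∀ xs y → sum (map (λ x → count (R? x) [ y ]) xs) ≡ count (λ x → R? x y) xs
  sum-count-singleton []       y = refl
  sum-count-singleton (x ∷ xs) y with R? x y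
  ... | yes _ = cong suc (sum-count-singleton xs y)
  ... | no _  = sum-count-singleton xs y

  sum-count-comm : ∀ xs ys → sum (map (λ x → count (R? x) ys) xs) ≡
                             sum (map (λ y → count (λ x → R? x y) xs) ys)
  sum-count-comm xs []       = trans (sum-map-const 0 xs) (ℕP.*-zeroʳ (length xs))
  sum-count-comm xs (y ∷ ys) = begin
    sum (map (λ x → count (R? x) (y ∷ ys)) xs)
      ≡⟨ cong sum (map-cong (λ x → count-++ (R? x) [ y ] ys) xs) ⟩
    sum (map (λ x → count (R? x) [ y ] + count (R? x) ys) xs)
      ≡⟨ sum-map-+ (λ x → count (R? x) [ y ]) (λ x → count (R? x) ys) xs ⟩
    sum (map (λ x → count (R? x) [ y ]) xs) + sum (map (λ x → count (R? x) ys) xs)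
      ≡⟨ cong₂ _+_ (sum-count-singleton xs y) (sum-count-comm xs ys) ⟩
    count (λ x → R? x y) xs + sum (map (λ y → count (λ x → R? x y) xs) ys) ∎
    where open ≡-Reasoning

module _ {A B C : Set} (f : A → B → C) where
  open import Data.Nat using (_+_; _*_)
  open ≡-Reasoning

  length-cartesianProductWith : ∀ xs ys →
    length (cartesianProductWith f xs ys) ≡ length xs * length ys
  length-cartesianProductWith []       ys = refl
  length-cartesianProductWith (x ∷ xs) ys = begin
    length (map (f x) ys ++ cartesianProductWith f xs ys)
      ≡⟨ length-++ (map (f x) ys) ⟩
    length (map (f x) ys) + length (cartesianProductWith f xs ys)
      ≡⟨ cong₂ _+_ (length-map (f x) ys) (length-cartesianProductWith xs ys) ⟩
    length ys + length xs * length ys ∎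

  count-cartesianProductWith : ∀ {ℓ} {P : Pred C ℓ} (P? : Decidable P) xs ys →
    count P? (cartesianProductWith f xs ys) ≡ sum (map (λ x → count (P? ∘ f x) ys) xs)
  count-cartesianProductWith P? []       ys = refl
  count-cartesianProductWith P? (x ∷ xs) ys = begin
    count P? (map (f x) ys ++ cartesianProductWith f xs ys)
      ≡⟨ count-++ P? (map (f x) ys) (cartesianProductWith f xs ys) ⟩
    count P? (map (f x) ys) + count P? (cartesianProductWith f xs ys)
      ≡⟨ cong₂ _+_ (count-map P? (f x) ys) (count-cartesianProductWith P? xs ys) ⟩
    count (P? ∘ f x) ys + sum (map (λ x → count (P? ∘ f x) ys) xs) ∎

module FieldCounting {q : ℕ} (𝔽 : FiniteField q) where
  open FiniteField 𝔽
  open IsCommutativeRing isCommutativeRing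
    using (zeroˡ; zeroʳ; +-identityˡ; *-identityʳ; *-assoc; *-comm; -‿inverseˡ; +-isGroup)

  +-group : Group _ _
  +-group = record { isGroup = +-isGroup }

  open import Algebra.Properties.Group +-group using (inverseˡ-unique)
  open Inverse enum using (to; from; strictlyInverseˡ; strictlyInverseʳ)

  1<q : 1 ℕ.< q
  1<q = 1<card enum
    where
    1<card : ∀ {n} → Fin n ↔ Carrier → 1 ℕ.< n
    1<card {zero} e with Inverse.from e 0#
    ... | ()
    1<card {suc zero} e with Inverse.from e 0# | Inverse.from e 1#
                           | Inverse.strictlyInverseˡ e 0# | Inverse.strictlyInverseˡ e 1#
    ... | zero | zero | to-from-0 | to-from-1 = contradiction (trans (sym to-from-0) to-from-1) 0≢1
    1<card {suc (suc n)} e = ℕ.s≤s (ℕ.s≤s ℕ.z≤n)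

  linear-root : ∀ {a} → a ≢ 0# → ∀ d → ∃ λ t → (λ c → c * a + d ≡ 0#) ≐ (_≡ t)
  linear-root {a} a≢0 d with inverse a a≢0
  ... | a⁻¹ , aa⁻¹≡1 = - d * a⁻¹ , root⇒ , ⇒root
    where
    open ≡-Reasoning
    root⇒ : ∀ {c} → c * a + d ≡ 0# → c ≡ - d * a⁻¹
    root⇒ {c} ca+d≡0 = begin
      c              ≡⟨ sym (*-identityʳ c) ⟩
      c * 1#         ≡⟨ cong (c *_) (sym aa⁻¹≡1) ⟩
      c * (a * a⁻¹)  ≡⟨ sym (*-assoc c a a⁻¹) ⟩
      c * a * a⁻¹    ≡⟨ cong (_* a⁻¹) (inverseˡ-unique (c * a) d ca+d≡0) ⟩
      - d * a⁻¹      ∎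
    ⇒root : ∀ {c} → c ≡ - d * a⁻¹ → c * a + d ≡ 0#
    ⇒root refl = begin
      - d * a⁻¹ * a + d    ≡⟨ cong (λ e → e + d) (*-assoc (- d) a⁻¹ a) ⟩
      - d * (a⁻¹ * a) + d  ≡⟨ cong (λ e → - d * e + d) (trans (*-comm a⁻¹ a) aa⁻¹≡1) ⟩
      - d * 1# + d         ≡⟨ cong (λ e → e + d) (*-identityʳ (- d)) ⟩
      - d + d              ≡⟨ -‿inverseˡ d ⟩
      0#                   ∎

  elements : List Carrier
  elements = map to (allFin q)

  length-elements : length elements ≡ q
  length-elements = trans (length-map to (allFin q)) (length-tabulate id)

  ∈-elements : ∀ c → c ∈ elements
  ∈-elements c = subst (_∈ elements) (strictlyInverseˡ c) (∈-map⁺ to (∈-allFin (from c)))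

  elements-unique : Unique elements
  elements-unique = Unique.map⁺ to-injective (Unique.allFin⁺ q)
    where
    to-injective : ∀ {i j} → to i ≡ to j → i ≡ j
    to-injective {i} {j} eq = trans (sym (strictlyInverseʳ i)) (trans (cong from eq) (strictlyInverseʳ j))

  count-linear-roots : ∀ {a} → a ≢ 0# → ∀ d → count (λ c → (c * a + d) ≟ 0#) elements ≡ 1
  count-linear-roots {a} a≢0 d with linear-root a≢0 d
  ... | t , root≐t = trans (cong length (filter-≐ (λ c → (c * a + d) ≟ 0#) (_≟ t) root≐t elements))
                           (count-≟-unique _≟_ elements-unique (∈-elements t))

  vectors : ∀ n → List (Vec Carrier n)
  vectors zero    = [ [] ]
  vectors (suc n) = cartesianProductWith (flip _∷_) (vectors n) elements

  length-vectors : ∀ n → length (vectors n) ≡ q ^ n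
  length-vectors zero    = refl
  length-vectors (suc n) = begin
    length (vectors (suc n))                ≡⟨ length-cartesianProductWith (flip _∷_) (vectors n) elements ⟩
    length (vectors n) ℕ.* length elements  ≡⟨ cong₂ ℕ._*_ (length-vectors n) length-elements ⟩
    q ^ n ℕ.* q                             ≡⟨ ℕP.*-comm (q ^ n) q ⟩
    q ^ suc n                             ∎
    where open ≡-Reasoning

  ∈-vectors : ∀ {n} (x : Vec Carrier n) → x ∈ vectors n
  ∈-vectors []      = here refl
  ∈-vectors (c ∷ x) = ∈-cartesianProductWith⁺ (flip _∷_) (∈-vectors x) (∈-elements c)

  private
    module _ {n : ℕ} where
      open Geometry 𝔽 n using (_·_) public

  ·-zeroˡ : ∀ {n} (x : Vec Carrier n) → replicate n 0# · x ≡ 0#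
  ·-zeroˡ []      = refl
  ·-zeroˡ (a ∷ x) = trans (cong₂ _+_ (zeroˡ a) (·-zeroˡ x)) (+-identityˡ 0#)

  module _ {n : ℕ} (x : Vec Carrier n) where
    open ≡-Reasoning

    count-annihilators-pivot : ∀ {a} → a ≢ 0# →
      count (λ h → (h · (a ∷ x)) ≟ 0#) (vectors (suc n)) ≡ q ^ n
    count-annihilators-pivot {a} a≢0 = begin
      count (λ h → (h · (a ∷ x)) ≟ 0#) (vectors (suc n))
        ≡⟨ count-cartesianProductWith (flip _∷_) (λ h → (h · (a ∷ x)) ≟ 0#) (vectors n) elements ⟩
      sum (map (λ h → count (λ c → (c * a + h · x) ≟ 0#) elements) (vectors n))
        ≡⟨ cong sum (map-cong (λ h → count-linear-roots a≢0 (h · x)) (vectors n)) ⟩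
      sum (map (λ _ → 1) (vectors n))
        ≡⟨ sum-map-const 1 (vectors n) ⟩
      length (vectors n) ℕ.* 1
        ≡⟨ ℕP.*-identityʳ (length (vectors n)) ⟩
      length (vectors n)
        ≡⟨ length-vectors n ⟩
      q ^ n ∎

    count-annihilators-0∷ : count (λ h → (h · (0# ∷ x)) ≟ 0#) (vectors (suc n)) ≡
                            q ℕ.* count (λ h → (h · x) ≟ 0#) (vectors n)
    count-annihilators-0∷ = begin
      count (λ h → (h · (0# ∷ x)) ≟ 0#) (vectors (suc n))
        ≡⟨ count-cartesianProductWith (flip _∷_) (λ h → (h · (0# ∷ x)) ≟ 0#) (vectors n) elements ⟩
      sum (map (λ h → count (λ c → (c * 0# + h · x) ≟ 0#) elements) (vectors n))
        ≡⟨ cong sum (map-cong (λ h → count-constant (h · x)) (vectors n)) ⟩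
      sum (map (λ h → count (λ _ → (h · x) ≟ 0#) elements) (vectors n))
        ≡⟨ sum-count-comm (λ h _ → (h · x) ≟ 0#) (vectors n) elements ⟩
      sum (map (λ _ → #annihilators) elements)
        ≡⟨ sum-map-const #annihilators elements ⟩
      length elements ℕ.* #annihilators
        ≡⟨ cong (ℕ._* #annihilators) length-elements ⟩
      q ℕ.* #annihilators ∎
      where
      #annihilators = count (λ h → (h · x) ≟ 0#) (vectors n)
      c*0+d≡d : ∀ c d → c * 0# + d ≡ d
      c*0+d≡d c d = trans (cong (λ e → e + d) (zeroʳ c)) (+-identityˡ d)
      count-constant : ∀ d →
        count (λ c → (c * 0# + d) ≟ 0#) elements ≡ count (λ _ → d ≟ 0#) elements
      count-constant d = cong length (filter-≐ (λ c → (c * 0# + d) ≟ 0#) (λ _ → d ≟ 0#)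
        (trans (sym (c*0+d≡d _ d)) , trans (c*0+d≡d _ d)) elements)

  -- That is, q^(n-1) annihilators, multiplied by q to avoid truncated subtraction.
  count-annihilators : ∀ {n} (x : Vec Carrier n) → x ≢ replicate n 0# →
                       q ℕ.* count (λ h → (h · x) ≟ 0#) (vectors n) ≡ q ^ n
  count-annihilators [] x≢0 = contradiction refl x≢0
  count-annihilators {suc n} (a ∷ x) ax≢0 with a ≟ 0#
  ... | no a≢0   = cong (q ℕ.*_) (count-annihilators-pivot x a≢0)
  ... | yes refl = begin
      q ℕ.* count (λ h → (h · (0# ∷ x)) ≟ 0#) (vectors (suc n))
        ≡⟨ cong (q ℕ.*_) (count-annihilators-0∷ x) ⟩
      q ℕ.* (q ℕ.* count (λ h → (h · x) ≟ 0#) (vectors n))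
        ≡⟨ cong (q ℕ.*_) (count-annihilators x (ax≢0 ∘ cong (0# ∷_))) ⟩
      q ℕ.* q ^ n ∎
    where open ≡-Reasoning

module _ {q : ℕ} (𝔽 : FiniteField q) (v : ℕ) where
  open import Data.Nat using (_*_; _<_)
  open FiniteField 𝔽 using (_≟_; 0#)
  open FieldCounting 𝔽
  open Geometry 𝔽 v

  meetKernel : PointSet → V → ℕ
  meetKernel C h = count (λ x → (h · x) ≟ 0#) (reps C)

  meetKernel-zero : ∀ C → meetKernel C zeroV ≡ size C
  meetKernel-zero C =
    cong length (filter-all (λ x → (zeroV · x) ≟ 0#) (All.universal ·-zeroˡ (reps C)))

  sum-meetKernel : ∀ C → q * sum (map (meetKernel C) (vectors v)) ≡ q ^ v * size C
  sum-meetKernel C = begin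
    q * sum (map (meetKernel C) (vectors v))
      ≡⟨ cong (q *_) (sum-count-comm (λ h x → (h · x) ≟ 0#) (vectors v) (reps C)) ⟩
    q * sum (map #annihilators (reps C))
      ≡⟨ sym (sum-map-*ˡ q #annihilators (reps C)) ⟩
    sum (map (λ x → q * #annihilators x) (reps C))
      ≡⟨ cong sum (map-cong-local (All.map (λ {x} → count-annihilators x) (nonzero C))) ⟩
    sum (map (λ _ → q ^ v) (reps C))
      ≡⟨ sum-map-const (q ^ v) (reps C) ⟩
    size C * q ^ v
      ≡⟨ ℕP.*-comm (size C) (q ^ v) ⟩
    q ^ v * size C ∎
    where
    open ≡-Reasoning
    #annihilators : V → ℕ
    #annihilators x = count (λ h → (h · x) ≟ 0#) (vectors v)

  ∃-hyperplane-q*meet<size : (C : PointSet) → reps C ≢ [] → ∃ λ H → q * meet C H < size C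
  ∃-hyperplane-q*meet<size C C≢[] = hyperplane (Any.satisfied (below-average q*meet n sum≤ zero-above))
    where
    n = size C
    instance
      n≢0 : ℕ.NonZero n
      n≢0 = length-nonZero C≢[]
    q*meet : V → ℕ
    q*meet h = q * meetKernel C h
    sum≤ : sum (map q*meet (vectors v)) ℕ.≤ length (vectors v) * n
    sum≤ = ℕP.≤-reflexive (begin
      sum (map q*meet (vectors v))             ≡⟨ sum-map-*ˡ q (meetKernel C) (vectors v) ⟩
      q * sum (map (meetKernel C) (vectors v)) ≡⟨ sum-meetKernel C ⟩
      q ^ v * n                                ≡⟨ cong (_* n) (sym (length-vectors v)) ⟩
      length (vectors v) * n                   ∎)
      where open ≡-Reasoning
    n<q*meet-zero : n < q*meet zeroV
    n<q*meet-zero = subst (n <_) (trans (ℕP.*-comm n q) (cong (q *_) (sym (meetKernel-zero C))))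
                          (ℕP.m<m*n n q 1<q)
    zero-above : Any (λ h → n < q*meet h) (vectors v)
    zero-above = lose (∈-vectors zeroV) n<q*meet-zero
    hyperplane : ∃ (λ h → q*meet h < n) → ∃ λ H → q * meet C H < n
    hyperplane (h , below) = (h , h≢0) , below
      where
      h≢0 : h ≢ zeroV
      h≢0 refl = ℕP.<-asym below n<q*meet-zero

module _ where
  open import Data.Integer using (_+_; _*_; _-_; -_; _≤_; _<_; 0ℤ; 1ℤ)
  open import Data.Integer.Divisibility.Signed using (_∣_)

  -- The arguments of _≋_[mod_] cannot be inferred: it relates absolute values in ℕ.
  ≋-trans : ∀ {m x y z : ℤ} → x ≋ y [mod m ] → y ≋ z [mod m ] → x ≋ z [mod m ]
  ≋-trans {m} {x} {y} {z} x≋y y≋z =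
    ∣⇒∣ᵤ (subst (m ∣_) (split x y z)
               (∣m∣n⇒∣m+n (∣ᵤ⇒∣ {m} {x - y} x≋y) (∣ᵤ⇒∣ {m} {y - z} y≋z)))
    where
    split : ∀ x y z → (x - y) + (y - z) ≡ x - z
    split = solve-∀

  ≋∧<⇒≤ : ∀ d {x z : ℤ} → x ≋ z [mod + d ] → x < z + + d → x ≤ z
  ≋∧<⇒≤ d {x} {z} x≋z x<z+d with ∣ᵤ⇒∣ x≋z
  ... | divides j x-z≡j*d = ℤP.i-j≤0⇒i≤j (begin
    x - z    ≡⟨ x-z≡j*d ⟩
    j * + d  ≤⟨ ℤP.*-monoʳ-≤-nonNeg (+ d) (ℤP.i<j⇒i≤pred[j] j<1) ⟩
    0ℤ       ∎)
    where
    open ℤP.≤-Reasoning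
    z+d-z≡1*d : ∀ z d → z + d + - z ≡ 1ℤ * d
    z+d-z≡1*d = solve-∀
    j<1 : j < 1ℤ
    j<1 = ℤP.*-cancelʳ-<-nonNeg (+ d)
            (subst₂ _<_ x-z≡j*d (z+d-z≡1*d z (+ d)) (ℤP.+-monoˡ-< (- z) x<z+d))

  i-j≡k⇒i≡k+j : ∀ {i j k : ℤ} → i - j ≡ k → i ≡ k + j
  i-j≡k⇒i≡k+j {i} {j} refl = identity i j
    where
    identity : ∀ i j → i ≡ (i - j) + j
    identity = solve-∀

-- For q = 1 + p, N and Y are |C| = aΔq + b and y = kΔq + (q-1)b with d = Δ.  The solver sees
-- q - 1 = p because + suc p is definitionally 1ℤ + + p.
module Decomposition (p d : ℕ) (a b k : ℤ) where
  open import Data.Integer using (_+_; _*_; _-_; _<_; 1ℤ)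

  q : ℕ
  q = suc p

  N Y m bound : ℤ
  N = a * + (d ℕ.* q) + b
  Y = k * + (d ℕ.* q) + + p * b
  m = b + k * + d
  bound = (a - 1ℤ) * + d + m

  b+Y≡m*q : b + Y ≡ m * + q
  b+Y≡m*q = trans (cong (λ t → b + (k * t + + p * b)) (ℤP.pos-* d q)) (identity b k (+ d) (+ p))
    where
    identity : ∀ b k d p → b + (k * (d * (1ℤ + p)) + p * b) ≡ (b + k * d) * (1ℤ + p)
    identity = solve-∀

  N≋b : N ≋ b [mod + d ]
  N≋b = ∣⇒∣ᵤ (divides (a * + q)
          (trans (cong (λ t → a * t + b - b) (ℤP.pos-* d q)) (identity a b (+ d) (+ q))))
    where
    identity : ∀ a b d q → a * (d * q) + b - b ≡ a * q * d
    identity = solve-∀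

  b≋bound : b ≋ bound [mod + d ]
  b≋bound = ∣⇒∣ᵤ (divides (1ℤ - a - k) (identity a b k (+ d)))
    where
    identity : ∀ a b k d → b - ((a - 1ℤ) * d + (b + k * d)) ≡ (1ℤ - a - k) * d
    identity = solve-∀

  q*[bound+d]≡N+Y : + q * (bound + + d) ≡ N + Y
  q*[bound+d]≡N+Y = trans (identity a b k (+ d) (+ p))
                           (cong (λ t → (a * t + b) + (k * t + + p * b)) (sym (ℤP.pos-* d q)))
    where
    identity : ∀ a b k d p → (1ℤ + p) * ((a - 1ℤ) * d + (b + k * d) + d) ≡
                             (a * (d * (1ℤ + p)) + b) + (k * (d * (1ℤ + p)) + p * b)
    identity = solve-∀

  q*x<N⇒x<bound+d : ∀ {x y : ℕ} → + y ≡ Y → + (q ℕ.* x) < N → + x < bound + + d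
  q*x<N⇒x<bound+d {x} {y} y≡Y q*x<N = ℤP.*-cancelˡ-<-nonNeg (+ q) (begin-strict
    + q * + x            ≡⟨ ℤP.pos-* q x ⟨
    + (q ℕ.* x)          <⟨ q*x<N ⟩
    N                    ≤⟨ ℤP.i≤i+j N (+ y) ⟩
    N + + y              ≡⟨ cong (_+_ N) y≡Y ⟩
    N + Y                ≡⟨ q*[bound+d]≡N+Y ⟨
    + q * (bound + + d)  ∎)
    where open ℤP.≤-Reasoning

lemma8 : (q : ℕ) → IsPrimePower q → (𝔽 : FiniteField q) → (v : ℕ)
    → (r : ℚ) → 0ℚ ℚ.< r
    → (Δ : ℕ) → Δ ^ (↧ₙ r) ≡ q ^ ∣ ↥ r ∣ → 1 ℕ.< Δ
    → let open Geometry 𝔽 v in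
      (C : PointSet) → reps C ≢ [] → Divisible Δ C
    → (a b : ℤ) → + size C ≡ a ℤ.* + (Δ ℕ.* q) ℤ.+ b
    → (y : ℕ) → + y ≋ + (q ∸ 1) ℤ.* b [mod + (Δ ℕ.* q) ]
    → Σ ℤ λ m → (b ℤ.+ + y ≡ m ℤ.* + q)
        × Σ Hyperplane λ H → (+ meet C H ℤ.≤ (a ℤ.- ℤ.1ℤ) ℤ.* + Δ ℤ.+ m)
                            × (+ meet C H ≋ b [mod + Δ ])
lemma8 zero _ 𝔽 = contradiction (FieldCounting.1<q 𝔽) λ ()
lemma8 (suc p) _ 𝔽 v _ _ Δ _ _ C C≢[] C-div a b |C|≡N y y≋pb
  with ∃-hyperplane-q*meet<size 𝔽 v C C≢[]
     | ∣ᵤ⇒∣ {+ (Δ ℕ.* suc p)} {+ y ℤ.- + p ℤ.* b} y≋pb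
... | H , q*meet<|C| | divides k y-pb≡kΔq =
  m , trans (cong (ℤ._+_ b) y≡Y) b+Y≡m*q , H , meet≤bound , meet≋b
  where
  open Geometry 𝔽 v
  open Decomposition p Δ a b k
  y≡Y : + y ≡ Y
  y≡Y = i-j≡k⇒i≡k+j y-pb≡kΔq
  meet≋b : + meet C H ≋ b [mod + Δ ]
  meet≋b = ≋-trans {+ Δ} {+ meet C H} {+ size C} {b} (C-div H)
                   (subst (λ t → t ≋ b [mod + Δ ]) (sym |C|≡N) N≋b)
  meet<bound+Δ : + meet C H ℤ.< bound ℤ.+ + Δ
  meet<bound+Δ = q*x<N⇒x<bound+d y≡Y (subst (ℤ._<_ (+ (q ℕ.* meet C H))) |C|≡N (ℤ.+<+ q*meet<|C|))
  meet≤bound : + meet C H ℤ.≤ bound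
  meet≤bound = ≋∧<⇒≤ Δ (≋-trans {+ Δ} {+ meet C H} {b} {bound} meet≋b b≋bound) meet<bound+Δ
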